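{- Let $q$ and $r$ be integers with $r\ge 1$ and $4\le q<r+3$. Then (a) $F_v(2_r;q-1)\ge F_v(2_r;q)+1$; (b) if $F_v(2_r;q)+1\ge R(q-1,3)$, then $F_v(2_r;q-1)> F_v(2_r;q)+1$.
   Context: All graphs are finite, simple and undirected; $\omega(G)$ is the clique number and $\alpha(G)$ the independence number. $R(p,3)$ is the smallest $n$ such that every graph on at least $n$ vertices has $\omega(G)\ge p$ or $\alpha(G)\ge 3$. $G\overset{v}{\to}(2_r)$ means that for every partition of $V(G)$ into $r$ pairwise disjoint (possibly empty) sets, some part contains two adjacent vertices (equivalently $\chi(G)\ge r+1$). $F_v(2_r;q)$ is the minimum of $|V(G)|$ over graphs $G$ with $G\overset{v}{\to}(2_r)$ and $\omega(G)<q$ (exists iff $q\ge 3$). -}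

module Defs where

open import Data.Nat using (ℕ; _≤_)
open import Data.Fin using (Fin)
open import Data.Bool using (Bool; true; false)
open import Data.Product using (Σ; ∃; _×_)
open import Data.Sum using (_⊎_)
open import Relation.Nullary using (¬_)
open import Relation.Binary.PropositionalEquality using (_≡_; _≢_)

record Graph (n : ℕ) : Set where
  field
    adj    : Fin n → Fin n → Bool
    sym    : ∀ i j → adj i j ≡ adj j i
    irrefl : ∀ i → adj i i ≡ false
open Graph public

HasClique : ∀ {n} → Graph n → ℕ → Set
HasClique {n} G p =
  Σ (Fin p → Fin n) λ f → (∀ i j → i ≢ j → adj G (f i) (f j) ≡ true)

HasIndep : ∀ {n} → Graph n → ℕ → Set
HasIndep {n} G p =
  Σ (Fin p → Fin n) λ f →
    (∀ i j → i ≢ j → f i ≢ f j) × (∀ i j → adj G (f i) (f j) ≡ false)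

CliqueLess : ∀ {n} → Graph n → ℕ → Set
CliqueLess G q = ¬ HasClique G q

-- G →v (2_r): every partition of V(G) into r (possibly empty) parts,
-- given as a map to Fin r, has a part containing two adjacent vertices.
VArrow : ∀ {n} → Graph n → ℕ → Set
VArrow {n} G r =
  (c : Fin n → Fin r) → ∃ λ i → ∃ λ j → adj G i j ≡ true × c i ≡ c j

IsMin : (ℕ → Set) → ℕ → Set
IsMin P m = P m × (∀ k → P k → m ≤ k)

IsFv : ℕ → ℕ → ℕ → Set
IsFv r q = IsMin (λ n → Σ (Graph n) λ G → VArrow G r × CliqueLess G q)

IsR3 : ℕ → ℕ → Set
IsR3 p = IsMin (λ n → ∀ m → n ≤ m → (G : Graph m) → HasClique G p ⊎ HasIndep G 3)

-- Let G witness F_v(2_r; q−1), so χ(G) > r and ω(G) < q − 1, and let I be an independent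
-- set of G. Delete I and add a single vertex adjacent to everything else. An r-colouring
-- of the new graph would r-colour G (give I the colour of the new vertex), and a clique
-- of it loses at most the new vertex in G, so it has no q-clique: hence
-- F_v(2_r; q) ≤ F_v(2_r; q−1) − (|I| − 1). Since G has more than r ≥ q − 2 vertices and no
-- (q−1)-clique, it has two non-adjacent vertices (|I| = 2); if moreover it has at least
-- R(q−1, 3) vertices, it has an independent triple (|I| = 3).
module Submission where

open import Defs hiding (sym)
open import Data.Nat using (ℕ; zero; suc; _≤_; _<_; _+_; _∸_; s≤s; z≤n; _≤?_)
open import Data.Nat.Properties
  using (≤-trans; ≤-pred; ≰⇒>; +-comm; +-suc; +-identityʳ; +-monoˡ-≤; +-mono-≤-<)
open import Data.Bool using (true; false; _∨_; _xor_)
open import Data.Bool.Properties using (∨-zeroʳ; ∨-identityʳ; xor-same; ¬-not)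
  renaming (_≟_ to _≟ᵇ_)
open import Data.Fin using (Fin; zero; suc; punchIn; punchOut; inject≤; _≟_)
open import Data.Fin.Properties
  using (suc-injective; punchInᵢ≢i; punchIn-injective; punchIn-punchOut;
         punchOut-cong; punchOut-injective; inject≤-injective; any?; all?; ¬∀⟶∃¬)
open import Data.Product using (Σ; ∃; _×_; _,_; proj₁)
open import Data.Sum using (_⊎_; inj₁; inj₂)
open import Function using (id; _∘_)
open import Relation.Nullary using (Dec; yes; no; does; contradiction)
open import Relation.Nullary.Decidable using (dec-true; dec-false; _⊎-dec_)
open import Relation.Binary.PropositionalEquality
  using (_≡_; _≢_; refl; sym; trans; cong; cong₂; subst; subst₂; module ≡-Reasoning)

private
  variable
    k m n q r s : ℕ

adj⇒≢ : (G : Graph n) {x y : Fin n} → adj G x y ≡ true → x ≢ y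
adj⇒≢ G {x} xy refl with () ← trans (sym xy) (irrefl G x)

clique-injective : (G : Graph n) (f : Fin k → Fin n) →
                   (∀ i j → i ≢ j → adj G (f i) (f j) ≡ true) →
                   ∀ i j → i ≢ j → f i ≢ f j
clique-injective G f clique i j i≢j = adj⇒≢ G (clique i j i≢j)

∃-punchIn-avoiding : (f : Fin (suc k) → Fin n) → (∀ i j → i ≢ j → f i ≢ f j) →
                     (v : Fin n) → ∃ λ i → ∀ a → f (punchIn i a) ≢ v
∃-punchIn-avoiding f f-inj v with any? (λ i → f i ≟ v)
... | yes (i , fi≡v) = i , λ a fa≡v →
  f-inj (punchIn i a) i (punchInᵢ≢i i a) (trans fa≡v (sym fi≡v))
... | no ∄i = zero , λ a fa≡v → ∄i (suc a , fa≡v)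

comap : (Fin m → Fin n) → Graph n → Graph m
comap f G = record
  { adj    = λ i j → adj G (f i) (f j)
  ; sym    = λ i j → Graph.sym G (f i) (f j)
  ; irrefl = λ i → irrefl G (f i)
  }

comap-CliqueLess : (G : Graph n) (f : Fin m → Fin n) →
                   CliqueLess G q → CliqueLess (comap f G) q
comap-CliqueLess G f ω<q (g , clique) = ω<q (f ∘ g , clique)

xor-comm : ∀ a b → a xor b ≡ b xor a
xor-comm false false = refl
xor-comm false true  = refl
xor-comm true  false = refl
xor-comm true  true  = refl

cone : Graph n → Fin n → Graph n
cone G v = record
  { adj    = λ i j → adj G i j ∨ (does (i ≟ v) xor does (j ≟ v))
  ; sym    = λ i j → cong₂ _∨_ (Graph.sym G i j) (xor-comm (does (i ≟ v)) (does (j ≟ v)))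
  ; irrefl = λ i → cong₂ _∨_ (irrefl G i) (xor-same (does (i ≟ v)))
  }

cone-adj-apex : (G : Graph n) {v j : Fin n} → j ≢ v → adj (cone G v) j v ≡ true
cone-adj-apex G {v} {j} j≢v =
  trans (cong₂ (λ a b → adj G j v ∨ (a xor b)) (dec-false (j ≟ v) j≢v) (dec-true (v ≟ v) refl))
        (∨-zeroʳ (adj G j v))

cone-adj : (G : Graph n) {v i j : Fin n} → i ≢ v → j ≢ v → adj (cone G v) i j ≡ adj G i j
cone-adj G {v} {i} {j} i≢v j≢v =
  trans (cong₂ (λ a b → adj G i j ∨ (a xor b)) (dec-false (i ≟ v) i≢v) (dec-false (j ≟ v) j≢v))
        (∨-identityʳ (adj G i j))

cone-CliqueLess : (G : Graph n) (v : Fin n) → CliqueLess G q → CliqueLess (cone G v) (suc q)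
cone-CliqueLess G v ω<q (f , clique)
  with i , avoids ← ∃-punchIn-avoiding f (clique-injective (cone G v) f clique) v =
  ω<q (f ∘ punchIn i , λ a b a≢b →
    trans (sym (cone-adj G (avoids a) (avoids b)))
          (clique _ _ (a≢b ∘ punchIn-injective i a b)))

-- π identifies the independent set π⁻¹(hub) to the vertex hub and is injective elsewhere,
-- with inverse ι.
record Collapse (G : Graph n) (m : ℕ) : Set where
  field
    hub               : Fin m
    π                 : Fin n → Fin m
    ι                 : Fin m → Fin n
    ι∘π               : ∀ x → π x ≢ hub → ι (π x) ≡ x
    fibre-independent : ∀ x y → π x ≡ hub → π y ≡ hub → adj G x y ≡ false
open Collapse

collapsed : {G : Graph n} → Collapse G m → Graph m
collapsed {G = G} C = cone (comap (ι C) G) (hub C)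

collapsed-VArrow : {G : Graph n} → VArrow G r → (C : Collapse G m) → VArrow (collapsed C) r
collapsed-VArrow {G = G} G→r C c with x , y , xy , cx≡cy ← G→r (c ∘ π C)
  with π C x ≟ hub C | π C y ≟ hub C
... | yes x↦hub | yes y↦hub
  with () ← trans (sym xy) (fibre-independent C x y x↦hub y↦hub)
... | yes x↦hub | no y↛hub =
  π C y , hub C , cone-adj-apex (comap (ι C) G) y↛hub , trans (sym cx≡cy) (cong c x↦hub)
... | no x↛hub | yes y↦hub =
  π C x , hub C , cone-adj-apex (comap (ι C) G) x↛hub , trans cx≡cy (cong c y↦hub)
... | no x↛hub | no y↛hub = π C x , π C y , edge , cx≡cy
  where
  edge : adj (collapsed C) (π C x) (π C y) ≡ true
  edge = trans (cone-adj (comap (ι C) G) x↛hub y↛hub)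
               (subst₂ (λ u w → adj G u w ≡ true)
                       (sym (ι∘π C x x↛hub)) (sym (ι∘π C y y↛hub)) xy)

collapsed-CliqueLess : {G : Graph n} (C : Collapse G m) →
                       CliqueLess G q → CliqueLess (collapsed C) (suc q)
collapsed-CliqueLess {G = G} C =
  cone-CliqueLess (comap (ι C) G) (hub C) ∘ comap-CliqueLess G (ι C)

trivialCollapse : (G : Graph n) → Fin n → Collapse G n
trivialCollapse G v = record
  { hub               = v
  ; π                 = id
  ; ι                 = id
  ; ι∘π               = λ _ _ → refl
  ; fibre-independent = λ { _ _ refl refl → irrefl G v }
  }

-- Adds t to the collapsed independent set: the vertex π t is removed and t is sent to hub.
module Extend {G : Graph n} (C : Collapse G (suc m)) (t : Fin n) (t∉fibre : π C t ≢ hub C)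
              (t⊥fibre : ∀ x → π C x ≡ hub C → adj G t x ≡ false) where

  hub′ : Fin m
  hub′ = punchOut t∉fibre

  πᵗ : (y : Fin (suc m)) → Dec (y ≡ π C t) → Fin m
  πᵗ y (yes _)  = hub′
  πᵗ y (no y≢t) = punchOut (y≢t ∘ sym)

  π′ : Fin n → Fin m
  π′ x = πᵗ (π C x) (π C x ≟ π C t)

  ι′ : Fin m → Fin n
  ι′ y = ι C (punchIn (π C t) y)

  π≡πt⇒≡t : ∀ x → π C x ≡ π C t → x ≡ t
  π≡πt⇒≡t x πx≡πt = begin
    x               ≡⟨ sym (ι∘π C x (t∉fibre ∘ trans (sym πx≡πt))) ⟩
    ι C (π C x)     ≡⟨ cong (ι C) πx≡πt ⟩
    ι C (π C t)     ≡⟨ ι∘π C t t∉fibre ⟩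
    t               ∎
    where open ≡-Reasoning

  extend-fibre : ∀ x → π′ x ≡ hub′ → π C x ≡ hub C ⊎ x ≡ t
  extend-fibre x π′x≡hub′ with π C x ≟ π C t
  ... | yes πx≡πt = inj₂ (π≡πt⇒≡t x πx≡πt)
  ... | no  _     = inj₁ (punchOut-injective _ t∉fibre π′x≡hub′)

  ι′∘π′ : ∀ x → π′ x ≢ hub′ → ι′ (π′ x) ≡ x
  ι′∘π′ x π′x≢hub′ with π C x ≟ π C t
  ... | yes _ = contradiction refl π′x≢hub′
  ... | no  _ = trans (cong (ι C) (punchIn-punchOut _))
                      (ι∘π C x (π′x≢hub′ ∘ punchOut-cong (π C t)))

  fibre-independent′ : ∀ x y → π′ x ≡ hub′ → π′ y ≡ hub′ → adj G x y ≡ false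
  fibre-independent′ x y x↦hub y↦hub with extend-fibre x x↦hub | extend-fibre y y↦hub
  ... | inj₁ x↦ | inj₁ y↦ = fibre-independent C x y x↦ y↦
  ... | inj₁ x↦ | inj₂ refl = trans (Graph.sym G x y) (t⊥fibre x x↦)
  ... | inj₂ refl | inj₁ y↦ = t⊥fibre y y↦
  ... | inj₂ refl | inj₂ refl = irrefl G x

  extend : Collapse G m
  extend = record
    { hub = hub′ ; π = π′ ; ι = ι′ ; ι∘π = ι′∘π′ ; fibre-independent = fibre-independent′ }

open Extend using (extend; extend-fibre)

collapseIndependent : (G : Graph n) (I : HasIndep G (suc s)) →
  ∃ λ m → m + s ≡ n × Σ (Collapse G m) λ C → ∀ x → π C x ≡ hub C → ∃ λ i → x ≡ proj₁ I i
collapseIndependent {s = zero} G (f , _ , _) =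
  _ , +-identityʳ _ , trivialCollapse G (f zero) , λ x x≡f0 → zero , x≡f0
collapseIndependent {s = suc s} G (f , f-inj , f-indep)
  with collapseIndependent G
         (f ∘ suc , (λ i j i≢j → f-inj _ _ (i≢j ∘ suc-injective)) , λ i j → f-indep _ _)
... | zero , _ , C , _ with () ← hub C
... | suc m , m+s≡n , C , within =
  m , trans (+-suc m s) m+s≡n , C′ , within′
  where
  t∉fibre : π C (f zero) ≢ hub C
  t∉fibre f0↦hub with i , f0≡fi ← within (f zero) f0↦hub = f-inj zero (suc i) (λ ()) f0≡fi
  t⊥fibre : ∀ x → π C x ≡ hub C → adj G (f zero) x ≡ false
  t⊥fibre x x↦hub with i , refl ← within x x↦hub = f-indep zero (suc i)
  C′ : Collapse G m
  C′ = extend C (f zero) t∉fibre t⊥fibre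
  within′ : ∀ x → π C′ x ≡ hub C′ → ∃ λ i → x ≡ f i
  within′ x x↦hub with extend-fibre C (f zero) t∉fibre t⊥fibre x x↦hub
  ... | inj₁ x↦ with i , x≡fi ← within x x↦ = suc i , x≡fi
  ... | inj₂ x≡f0 = zero , x≡f0

removeIndependentSet : (G : Graph n) → VArrow G r → CliqueLess G q → HasIndep G (suc s) →
  ∃ λ m → m + s ≡ n × Σ (Graph m) λ H → VArrow H r × CliqueLess H (suc q)
removeIndependentSet G G→r ω<q I with m , m+s≡n , C , _ ← collapseIndependent G I =
  m , m+s≡n , collapsed C , collapsed-VArrow G→r C , collapsed-CliqueLess C ω<q

VArrow⇒< : (G : Graph n) → VArrow G r → r < n
VArrow⇒< {n} {r} G G→r with n ≤? r
... | no n≰r = ≰⇒> n≰r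
... | yes n≤r with i , j , ij , ci≡cj ← G→r (λ i → inject≤ i n≤r) =
  contradiction (inject≤-injective n≤r n≤r i j ci≡cj) (adj⇒≢ G ij)

independentPair : (G : Graph n) {u v : Fin n} → u ≢ v → adj G u v ≡ false → HasIndep G 2
independentPair {n} G {u} {v} u≢v uv = pair , distinct , independent
  where
  pair : Fin 2 → Fin n
  pair zero       = u
  pair (suc zero) = v
  distinct : ∀ i j → i ≢ j → pair i ≢ pair j
  distinct zero       zero       i≢j = contradiction refl i≢j
  distinct zero       (suc zero) _   = u≢v
  distinct (suc zero) zero       _   = u≢v ∘ sym
  distinct (suc zero) (suc zero) i≢j = contradiction refl i≢j
  independent : ∀ i j → adj G (pair i) (pair j) ≡ false
  independent zero       zero       = irrefl G u
  independent zero       (suc zero) = uv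
  independent (suc zero) zero       = trans (Graph.sym G v u) uv
  independent (suc zero) (suc zero) = irrefl G v

adjacent-or-equal? : (G : Graph n) (i j : Fin n) → Dec (adj G i j ≡ true ⊎ i ≡ j)
adjacent-or-equal? G i j = (adj G i j ≟ᵇ true) ⊎-dec (i ≟ j)

nonadjacentPair : (G : Graph n) → CliqueLess G k → k ≤ n → HasIndep G 2
nonadjacentPair {n = n} {k = k} G ω<k k≤n with all? (λ i → all? (adjacent-or-equal? G i))
... | yes complete = contradiction (embed , clique) ω<k
  where
  embed : Fin k → Fin n
  embed i = inject≤ i k≤n
  clique : ∀ i j → i ≢ j → adj G (embed i) (embed j) ≡ true
  clique i j i≢j with complete (embed i) (embed j)
  ... | inj₁ ij   = ij
  ... | inj₂ i≡j = contradiction (inject≤-injective k≤n k≤n i j i≡j) i≢j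
... | no incomplete
  with u , ¬complete-u ← ¬∀⟶∃¬ n _ (λ i → all? (adjacent-or-equal? G i)) incomplete
  with v , ¬uv ← ¬∀⟶∃¬ n _ (adjacent-or-equal? G u) ¬complete-u =
  independentPair G (¬uv ∘ inj₂) (¬-not (¬uv ∘ inj₁))

-- The argument only needs q ≤ r + 2.
corollary2p1 : (q r : ℕ) → 1 ≤ r → 4 ≤ q → q < r + 3 →
    (a b : ℕ) → IsFv r (q ∸ 1) a → IsFv r q b →
    (b + 1 ≤ a) × ((R : ℕ) → IsR3 (q ∸ 1) R → R ≤ b + 1 → b + 1 < a)
corollary2p1 (suc q) r _ _ q<r+3 a b ((G , G→r , ω<q) , _) (_ , Fv-minimal) = part-a , part-b
  where
  q≤a : q ≤ a
  q≤a = ≤-trans (≤-pred (≤-pred (subst (suc (suc q) ≤_) (+-comm r 3) q<r+3))) (VArrow⇒< G G→r)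

  part-a : b + 1 ≤ a
  part-a with m , m+1≡a , H ← removeIndependentSet G G→r ω<q (nonadjacentPair G ω<q q≤a) =
    subst (b + 1 ≤_) m+1≡a (+-monoˡ-≤ 1 (Fv-minimal m H))

  part-b : (R : ℕ) → IsR3 q R → R ≤ b + 1 → b + 1 < a
  part-b R (ramsey , _) R≤b+1 with ramsey a (≤-trans R≤b+1 part-a) G
  ... | inj₁ clique = contradiction clique ω<q
  ... | inj₂ triple with m , m+2≡a , H ← removeIndependentSet G G→r ω<q triple =
    subst (b + 1 <_) m+2≡a (+-mono-≤-< (Fv-minimal m H) (s≤s (s≤s z≤n)))
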